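{- Let $\mathcal{B}_{\mathcal{P}_2}$ be the set of partitions $\lambda=(\lambda_1,\ldots,\lambda_\ell)$ with $\ell\ge1$ whose odd-indexed parts are even, which satisfy $0\le\lambda_i-\lambda_{i+1}\le1$ for $1\le i<\ell$, and whose smallest part satisfies $\lambda_\ell\in\{1,2\}$. For integers $m\ge1$ and $h$, let $B_{\mathcal{P}_2}(m,h)=\sum\omega(\lambda)$, the sum over $\lambda\in\mathcal{B}_{\mathcal{P}_2}$ with $\ell(\lambda)=m$ and $\lambda_1=h$. Then for all positive integers $n$ and $h$: $$B_{\mathcal{P}_2}(2n,2h)=Q^{\binom{h}{2}+n}(1+d^{ -1})d^{1-h}{n-1\brack h-1}_{Q},\qquad B_{\mathcal{P}_2}(2n-1,2h)=abQ^{\binom{h}{2}+n-1}d^{1-h}{n-1\brack h-1}_{Q}.$$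
   Context: Partitions are finite weakly decreasing sequences of positive integers; $\ell(\lambda)$ is the length and $\lambda_i=0$ for $i>\ell(\lambda)$. The four-parameter weight is $\omega(\lambda)=a^{\sum_{i\ge1}\lceil\lambda_{2i-1}/2\rceil}b^{\sum_{i\ge1}\lfloor\lambda_{2i-1}/2\rfloor}c^{\sum_{i\ge1}\lceil\lambda_{2i}/2\rceil}d^{\sum_{i\ge1}\lfloor\lambda_{2i}/2\rfloor}$, and $Q=abcd$. The $Q$-binomial coefficient is ${N\brack k}_Q=\frac{(Q;Q)_N}{(Q;Q)_k(Q;Q)_{N-k}}$ for $0\le k\le N$ and $0$ otherwise, where $(Q;Q)_N=\prod_{i=1}^{N}(1-Q^i)$; $\binom{m}{2}=m(m-1)/2$. -}

module Defs where

open import Level using (Level)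
open import Algebra.Bundles using (CommutativeRing)
open import Data.Nat using (ℕ; zero; suc; _≤_; _≤?_; _≟_; ⌈_/2⌉; ⌊_/2⌋)
open import Data.Nat.Divisibility using (_∣_; _∣?_)
open import Data.List using (List; []; _∷_; [_]; map; concatMap; upTo; filter; foldr)
open import Data.List.Relation.Unary.All using (All; all?)
open import Data.Product using (_×_; _,_)
open import Data.Sum using (_⊎_)
open import Data.Unit using (⊤; tt)
open import Data.Empty using (⊥)
open import Relation.Nullary using (Dec; yes; no)
open import Relation.Nullary.Decidable using (_×-dec_; _⊎-dec_)
open import Relation.Binary.PropositionalEquality using (_≡_)

-- Partitions are represented as lists of naturals (λ₁ ∷ λ₂ ∷ … ∷ λ_ℓ).

Positive : List ℕ → Set
Positive = All (λ x → 1 ≤ x)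

Chain : List ℕ → Set
Chain [] = ⊤
Chain (x ∷ []) = ⊤
Chain (x ∷ y ∷ xs) = (y ≤ x × x ≤ suc y) × Chain (y ∷ xs)

OddIndexedEven : List ℕ → Set
OddIndexedEven [] = ⊤
OddIndexedEven (x ∷ []) = 2 ∣ x
OddIndexedEven (x ∷ y ∷ xs) = 2 ∣ x × OddIndexedEven xs

LastIn12 : List ℕ → Set
LastIn12 [] = ⊥
LastIn12 (x ∷ []) = x ≡ 1 ⊎ x ≡ 2
LastIn12 (x ∷ y ∷ xs) = LastIn12 (y ∷ xs)

InBP2 : List ℕ → Set
InBP2 λs = Positive λs × Chain λs × OddIndexedEven λs × LastIn12 λs

FirstIs : ℕ → List ℕ → Set
FirstIs h [] = ⊥
FirstIs h (x ∷ _) = x ≡ h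

chain? : (xs : List ℕ) → Dec (Chain xs)
chain? [] = yes tt
chain? (x ∷ []) = yes tt
chain? (x ∷ y ∷ xs) = ((y ≤? x) ×-dec (x ≤? suc y)) ×-dec chain? (y ∷ xs)

oddIndexedEven? : (xs : List ℕ) → Dec (OddIndexedEven xs)
oddIndexedEven? [] = yes tt
oddIndexedEven? (x ∷ []) = 2 ∣? x
oddIndexedEven? (x ∷ y ∷ xs) = (2 ∣? x) ×-dec oddIndexedEven? xs

lastIn12? : (xs : List ℕ) → Dec (LastIn12 xs)
lastIn12? [] = no (λ ())
lastIn12? (x ∷ []) = (x ≟ 1) ⊎-dec (x ≟ 2)
lastIn12? (x ∷ y ∷ xs) = lastIn12? (y ∷ xs)

firstIs? : (h : ℕ) (xs : List ℕ) → Dec (FirstIs h xs)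
firstIs? h [] = no (λ ())
firstIs? h (x ∷ _) = x ≟ h

inBP2? : (xs : List ℕ) → Dec (InBP2 xs)
inBP2? xs = all? (λ x → 1 ≤? x) xs ×-dec chain? xs ×-dec oddIndexedEven? xs ×-dec lastIn12? xs

Selected : ℕ → List ℕ → Set
Selected h xs = InBP2 xs × FirstIs h xs

selected? : (h : ℕ) (xs : List ℕ) → Dec (Selected h xs)
selected? h xs = inBP2? xs ×-dec firstIs? h xs

-- all lists of length m with entries in {0,…,h}, each exactly once.
-- Every partition of length m with largest part λ₁ = h occurs here.
lists : ℕ → ℕ → List (List ℕ)
lists zero h = [ [] ]
lists (suc m) h = concatMap (λ x → map (x ∷_) (lists m h)) (upTo (suc h))

module _ {c ℓ : Level} (R : CommutativeRing c ℓ) where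
  open CommutativeRing R

  pow : Carrier → ℕ → Carrier
  pow x zero = 1#
  pow x (suc n) = x * pow x n

  -- ω(λ) = a^{Σ⌈λ_{2i-1}/2⌉} b^{Σ⌊λ_{2i-1}/2⌋} c^{Σ⌈λ_{2i}/2⌉} d^{Σ⌊λ_{2i}/2⌋},
  -- computed part by part (odd-indexed parts use a,b; even-indexed use c,d)
  ωodd ωeven : (a b c d : Carrier) → List ℕ → Carrier
  ωodd a b c d [] = 1#
  ωodd a b c d (x ∷ xs) = pow a ⌈ x /2⌉ * pow b ⌊ x /2⌋ * ωeven a b c d xs
  ωeven a b c d [] = 1#
  ωeven a b c d (x ∷ xs) = pow c ⌈ x /2⌉ * pow d ⌊ x /2⌋ * ωodd a b c d xs

  ω : (a b c d : Carrier) → List ℕ → Carrier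
  ω = ωodd

  sumR : List Carrier → Carrier
  sumR = foldr _+_ 0#

  BP2 : (a b c d : Carrier) → ℕ → ℕ → Carrier
  BP2 a b c d m h = sumR (map (ω a b c d) (filter (selected? h) (lists m h)))

  qbinom : Carrier → ℕ → ℕ → Carrier
  qbinom q N zero = 1#
  qbinom q zero (suc k) = 0#
  qbinom q (suc N) (suc k) = qbinom q N k + pow q (suc k) * qbinom q N (suc k)

{-# OPTIONS --safe #-}
module Submission where

open import Defs
open import Algebra.Bundles using (CommutativeRing)
open import Data.Nat using (ℕ; zero; suc; _≤_; _<_; _∸_; s≤s; z≤n; ⌊_/2⌋; ⌈_/2⌉)
  renaming (_*_ to _ℕ*_; _+_ to _ℕ+_)
open import Data.Nat.Combinatorics using (_C_; nCk+nC[k+1]≡[n+1]C[k+1]; nC1≡n)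
open import Data.Nat.Divisibility using (_∣_; _∣?_; divides; ∣-refl; ∣m∣n⇒∣m+n; m∣m*n)
open import Data.Nat.Properties as ℕ
  using (_≤?_; _≟_; ≤-refl; ≤-trans; ≤-antisym; m≤n⇒m<n∨m≡n; m≤n⇒m≤1+n; n≤1+n; m≤m+n;
         m∸n≤m; *-monoʳ-≤; *-suc; +-suc; suc-injective; 1+n≢n; even≢odd; n≡⌊n+n/2⌋; n≡⌈n+n/2⌉)
open import Data.Bool.Base using (Bool; true; false; not; if_then_else_)
open import Data.Empty using (⊥)
open import Data.List.Base using (List; []; _∷_; [_]; _++_; map; concatMap; filter; upTo)
open import Data.List.Properties using (map-∘; map-cong; map-upTo; map-applyUpTo)
open import Data.List.Relation.Unary.All using ([]; _∷_)
open import Data.Product using (_×_; _,_; proj₁; proj₂)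
open import Data.Sum using (_⊎_; inj₁; inj₂)
open import Data.Unit using (⊤; tt)
open import Function using (_∘_; _⇔_; mk⇔)
open import Relation.Nullary using (Dec; yes; no; does; _because_; ¬_; contradiction)
open import Relation.Nullary.Decidable using (_×-dec_; _⊎-dec_; dec-true; dec-false; does-⇔)
open import Relation.Unary using (Decidable)
open import Relation.Binary.PropositionalEquality as ≡ using (_≡_; _≢_)

-- Membership in B_{P₂} only constrains consecutive parts, so the weighted count `tails p m k` of
-- admissible tails of length m with first part k obeys a transfer recursion: the next part is k or
-- k ∸ 1.  Odd parts are forbidden at odd indices, so two steps from an even part 2k+2 at an odd
-- index lead only to 2k+2 (through 2k+2, contributing Q^{k+1}) or to 2k (through 2k+1,
-- contributing Q^k·abc).  Hence, for ℓ₀ = 1, 2, f n k = tails true (ℓ₀ + 2n) (2k) satisfies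
--   f (n+1) (k+1) = Q^{k+1} · f n (k+1) + Q^k · abc · f n k,
-- a form of the Q-Pascal rule, solved by f n (h+1) = f 0 1 · Q^{C(h,2)+n} · (abc)^h · [n h]_Q,
-- where f 0 1 is ab for ℓ₀ = 1 and Q + abc for ℓ₀ = 2.  Finally abc = Q·d⁻¹ turns (abc)^h into
-- Q^h·d^{-h}.

⌊2*n/2⌋≡n : ∀ n → ⌊ 2 ℕ* n /2⌋ ≡ n
⌊2*n/2⌋≡n n = ≡.trans (≡.cong (λ m → ⌊ n ℕ+ m /2⌋) (ℕ.+-identityʳ n))
                      (≡.sym (n≡⌊n+n/2⌋ n))

⌈2*n/2⌉≡n : ∀ n → ⌈ 2 ℕ* n /2⌉ ≡ n
⌈2*n/2⌉≡n n = ≡.trans (≡.cong (λ m → ⌈ n ℕ+ m /2⌉) (ℕ.+-identityʳ n))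
                      (≡.sym (n≡⌈n+n/2⌉ n))

2∣2+2*n : ∀ n → 2 ∣ 2 ℕ+ 2 ℕ* n
2∣2+2*n n = ∣m∣n⇒∣m+n ∣-refl (m∣m*n n)

2∤1+2*n : ∀ n → ¬ 2 ∣ suc (2 ℕ* n)
2∤1+2*n n (divides q 1+2n≡q*2) = even≢odd q n (≡.trans (ℕ.*-comm 2 q) (≡.sym 1+2n≡q*2))

[1+h]C2≡h+hC2 : ∀ h → suc h C 2 ≡ h ℕ+ h C 2
[1+h]C2≡h+hC2 h = ≡.trans (≡.sym (nCk+nC[k+1]≡[n+1]C[k+1] h 1)) (≡.cong (_ℕ+ h C 2) (nC1≡n h))

adjacent⇔ : ∀ {y k} → (y ≤ suc k × suc k ≤ suc y) ⇔ (y ≡ suc k ⊎ y ≡ k)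
adjacent⇔ = mk⇔ to from
  where
  to : ∀ {y k} → y ≤ suc k × suc k ≤ suc y → y ≡ suc k ⊎ y ≡ k
  to (y≤1+k , s≤s k≤y) with m≤n⇒m<n∨m≡n y≤1+k
  ... | inj₁ (s≤s y≤k) = inj₂ (≤-antisym y≤k k≤y)
  ... | inj₂ y≡1+k = inj₁ y≡1+k
  from : ∀ {y k} → y ≡ suc k ⊎ y ≡ k → y ≤ suc k × suc k ≤ suc y
  from (inj₁ ≡.refl) = ≤-refl , n≤1+n _
  from (inj₂ ≡.refl) = n≤1+n _ , ≤-refl

-- Throughout, the Bool p says whether the part at hand sits at an odd index (λ₁, λ₃, …).
EvenAt : Bool → ℕ → Set
EvenAt true x = 2 ∣ x
EvenAt false _ = ⊤

AdmissiblePart : Bool → ℕ → Set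
AdmissiblePart p x = 1 ≤ x × EvenAt p x

ValidTail : Bool → List ℕ → Set
ValidTail p [] = ⊥
ValidTail p (x ∷ []) = AdmissiblePart p x × (x ≡ 1 ⊎ x ≡ 2)
ValidTail p (x ∷ y ∷ ys) = AdmissiblePart p x × (y ≤ x × x ≤ suc y) × ValidTail (not p) (y ∷ ys)

OddIndexedEvenFrom : Bool → List ℕ → Set
OddIndexedEvenFrom true xs = OddIndexedEven xs
OddIndexedEvenFrom false [] = ⊤
OddIndexedEvenFrom false (_ ∷ xs) = OddIndexedEven xs

validTail⇔ : ∀ p xs → (Positive xs × Chain xs × OddIndexedEvenFrom p xs × LastIn12 xs) ⇔ ValidTail p xs
validTail⇔ p xs = mk⇔ (to p xs) (from p xs)
  where
  to : ∀ p xs → Positive xs × Chain xs × OddIndexedEvenFrom p xs × LastIn12 xs → ValidTail p xs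
  to p [] (_ , _ , _ , ())
  to true (x ∷ []) (1≤x ∷ _ , _ , 2∣x , last) = (1≤x , 2∣x) , last
  to false (x ∷ []) (1≤x ∷ _ , _ , _ , last) = (1≤x , tt) , last
  to true (x ∷ y ∷ ys) (1≤x ∷ pos , (adj , chain) , (2∣x , even) , last) =
    (1≤x , 2∣x) , adj , to false (y ∷ ys) (pos , chain , even , last)
  to false (x ∷ y ∷ ys) (1≤x ∷ pos , (adj , chain) , even , last) =
    (1≤x , tt) , adj , to true (y ∷ ys) (pos , chain , even , last)
  from : ∀ p xs → ValidTail p xs → Positive xs × Chain xs × OddIndexedEvenFrom p xs × LastIn12 xs
  from true (x ∷ []) ((1≤x , 2∣x) , last) = 1≤x ∷ [] , tt , 2∣x , last
  from false (x ∷ []) ((1≤x , _) , last) = 1≤x ∷ [] , tt , tt , last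
  from true (x ∷ y ∷ ys) ((1≤x , 2∣x) , adj , valid) =
    let pos , chain , even , last = from false (y ∷ ys) valid
    in  1≤x ∷ pos , (adj , chain) , (2∣x , even) , last
  from false (x ∷ y ∷ ys) ((1≤x , _) , adj , valid) =
    let pos , chain , even , last = from true (y ∷ ys) valid
    in  1≤x ∷ pos , (adj , chain) , even , last

evenAt? : ∀ p x → Dec (EvenAt p x)
evenAt? true x = 2 ∣? x
evenAt? false _ = yes tt

admissible? : ∀ p x → Dec (AdmissiblePart p x)
admissible? p x = 1 ≤? x ×-dec evenAt? p x

validTail? : ∀ p xs → Dec (ValidTail p xs)
validTail? p [] = no λ ()
validTail? p (x ∷ []) = admissible? p x ×-dec (x ≟ 1 ⊎-dec x ≟ 2)
validTail? p (x ∷ y ∷ ys) =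
  admissible? p x ×-dec (y ≤? x ×-dec x ≤? suc y) ×-dec validTail? (not p) (y ∷ ys)

module _ {r ℓ} (R : CommutativeRing r ℓ) where
  open CommutativeRing R renaming (_*_ to _·_) hiding (zero)
  open import Algebra.Properties.CommutativeSemiring.Exp commutativeSemiring
    using (_^_; ^-homo-*; ^-distrib-*; ^-congˡ)
  open import Algebra.Properties.CommutativeSemigroup +-commutativeSemigroup using (interchange)
  open import Algebra.Solver.Ring.NaturalCoefficients.Default commutativeSemiring using (solve; _:=_; _:+_; _:*_; con)
  open import Relation.Binary.Reasoning.Setoid setoid

  pow≡^ : ∀ x n → pow R x n ≡ x ^ n
  pow≡^ x zero = ≡.refl
  pow≡^ x (suc n) = ≡.cong (x ·_) (pow≡^ x n)

  pow-+ : ∀ x m n → pow R x (m ℕ+ n) ≈ pow R x m · pow R x n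
  pow-+ x m n = begin
    pow R x (m ℕ+ n)       ≡⟨ pow≡^ x (m ℕ+ n) ⟩
    x ^ (m ℕ+ n)           ≈⟨ ^-homo-* x m n ⟩
    x ^ m · x ^ n          ≡⟨ ≡.cong₂ _·_ (pow≡^ x m) (pow≡^ x n) ⟨
    pow R x m · pow R x n  ∎

  pow-distrib-· : ∀ x y n → pow R (x · y) n ≈ pow R x n · pow R y n
  pow-distrib-· x y n = begin
    pow R (x · y) n        ≡⟨ pow≡^ (x · y) n ⟩
    (x · y) ^ n            ≈⟨ ^-distrib-* x y n ⟩
    x ^ n · y ^ n          ≡⟨ ≡.cong₂ _·_ (pow≡^ x n) (pow≡^ y n) ⟨
    pow R x n · pow R y n  ∎

  pow-congˡ : ∀ {x y} n → x ≈ y → pow R x n ≈ pow R y n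
  pow-congˡ {x} {y} n x≈y = begin
    pow R x n  ≡⟨ pow≡^ x n ⟩
    x ^ n      ≈⟨ ^-congˡ n x≈y ⟩
    y ^ n      ≡⟨ pow≡^ y n ⟨
    pow R y n  ∎

  pow-C2-suc : ∀ x h n → pow R x (suc h C 2 ℕ+ n) ≈ pow R x h · pow R x (h C 2 ℕ+ n)
  pow-C2-suc x h n = begin
    pow R x (suc h C 2 ℕ+ n)      ≡⟨ ≡.cong (λ m → pow R x (m ℕ+ n)) ([1+h]C2≡h+hC2 h) ⟩
    pow R x (h ℕ+ h C 2 ℕ+ n)     ≡⟨ ≡.cong (pow R x) (ℕ.+-assoc h (h C 2) n) ⟩
    pow R x (h ℕ+ (h C 2 ℕ+ n))   ≈⟨ pow-+ x h (h C 2 ℕ+ n) ⟩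
    pow R x h · pow R x (h C 2 ℕ+ n) ∎

  indicator : {P : Set} → Dec P → Carrier → Carrier
  indicator P? w = if does P? then w else 0#

  indicator-yes : ∀ {P} (P? : Dec P) {w : Carrier} → P → indicator P? w ≡ w
  indicator-yes P? {w} p = ≡.cong (λ b → if b then w else 0#) (dec-true P? p)

  indicator-no : ∀ {P} (P? : Dec P) {w : Carrier} → ¬ P → indicator P? w ≡ 0#
  indicator-no P? {w} ¬p = ≡.cong (λ b → if b then w else 0#) (dec-false P? ¬p)

  indicator-⇔ : ∀ {P P′} → P ⇔ P′ → (P? : Dec P) (P′? : Dec P′) {w : Carrier} →
                indicator P? w ≡ indicator P′? w
  indicator-⇔ P⇔P′ P? P′? {w} = ≡.cong (λ b → if b then w else 0#) (does-⇔ P⇔P′ P? P′?)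

  indicator-× : ∀ {P P′} (P? : Dec P) (P′? : Dec P′) {w : Carrier} →
                indicator (P? ×-dec P′?) w ≡ indicator P? (indicator P′? w)
  indicator-× (true because _) P′? = ≡.refl
  indicator-× (false because _) P′? = ≡.refl

  indicator-comm : ∀ {P P′} (P? : Dec P) (P′? : Dec P′) {w : Carrier} →
                   indicator P? (indicator P′? w) ≡ indicator P′? (indicator P? w)
  indicator-comm (true because _) (true because _) = ≡.refl
  indicator-comm (true because _) (false because _) = ≡.refl
  indicator-comm (false because _) (true because _) = ≡.refl
  indicator-comm (false because _) (false because _) = ≡.refl

  indicator-⊎ : ∀ {P P′} (P? : Dec P) (P′? : Dec P′) {w : Carrier} → ¬ (P × P′) →
                indicator (P? ⊎-dec P′?) w ≈ indicator P? w + indicator P′? w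
  indicator-⊎ (yes p) (yes p′) ¬both = contradiction (p , p′) ¬both
  indicator-⊎ (yes _) (no _) _ = sym (+-identityʳ _)
  indicator-⊎ (no _) (yes _) _ = sym (+-identityˡ _)
  indicator-⊎ (no _) (no _) _ = sym (+-identityʳ 0#)

  indicator-adjacent : ∀ y k {w : Carrier} →
    indicator (y ≤? suc k ×-dec suc k ≤? suc y) w ≈ indicator (y ≟ suc k) w + indicator (y ≟ k) w
  indicator-adjacent y k =
    trans (reflexive (indicator-⇔ adjacent⇔ (y ≤? suc k ×-dec suc k ≤? suc y) (y ≟ suc k ⊎-dec y ≟ k)))
          (indicator-⊎ (y ≟ suc k) (y ≟ k) λ (y≡1+k , y≡k) → 1+n≢n (≡.trans (≡.sym y≡1+k) y≡k))

  indicator-cong : ∀ {P} (P? : Dec P) {w w′} → w ≈ w′ → indicator P? w ≈ indicator P? w′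
  indicator-cong (true because _) w≈w′ = w≈w′
  indicator-cong (false because _) _ = refl

  indicator-*ˡ : ∀ {P} (P? : Dec P) {u w} → indicator P? (u · w) ≈ u · indicator P? w
  indicator-*ˡ (true because _) = refl
  indicator-*ˡ (false because _) = sym (zeroʳ _)

  indicator-0# : ∀ {P} (P? : Dec P) → indicator P? 0# ≡ 0#
  indicator-0# (true because _) = ≡.refl
  indicator-0# (false because _) = ≡.refl

  ∑ : {A : Set} → List A → (A → Carrier) → Carrier
  ∑ L f = sumR R (map f L)

  syntax ∑ L (λ x → e) = ∑[ x ∈ L ] e

  ∑-cong : ∀ {A} (L : List A) {f g : A → Carrier} → (∀ x → f x ≈ g x) → ∑ L f ≈ ∑ L g
  ∑-cong [] _ = refl
  ∑-cong (x ∷ L) f≈g = +-cong (f≈g x) (∑-cong L f≈g)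

  ∑-zero : ∀ {A} (L : List A) {f : A → Carrier} → (∀ x → f x ≈ 0#) → ∑ L f ≈ 0#
  ∑-zero [] _ = refl
  ∑-zero (x ∷ L) f≈0 = trans (+-cong (f≈0 x) (∑-zero L f≈0)) (+-identityʳ 0#)

  ∑-+ : ∀ {A} (L : List A) {f g : A → Carrier} → ∑[ x ∈ L ] (f x + g x) ≈ ∑ L f + ∑ L g
  ∑-+ [] = sym (+-identityʳ 0#)
  ∑-+ (x ∷ L) = trans (+-congˡ (∑-+ L)) (interchange _ _ _ _)

  ∑-*ˡ : ∀ {A} (L : List A) {u} {f : A → Carrier} → ∑[ x ∈ L ] (u · f x) ≈ u · ∑ L f
  ∑-*ˡ [] = sym (zeroʳ _)
  ∑-*ˡ (x ∷ L) = trans (+-congˡ (∑-*ˡ L)) (sym (distribˡ _ _ _))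

  ∑-indicator : ∀ {A P} (P? : Dec P) (L : List A) {f : A → Carrier} →
                ∑[ x ∈ L ] indicator P? (f x) ≈ indicator P? (∑ L f)
  ∑-indicator (true because _) L = refl
  ∑-indicator (false because _) L = ∑-zero L (λ _ → refl)

  ∑-++ : ∀ {A} (L M : List A) {f : A → Carrier} → ∑ (L ++ M) f ≈ ∑ L f + ∑ M f
  ∑-++ [] M = sym (+-identityˡ _)
  ∑-++ (x ∷ L) M = trans (+-congˡ (∑-++ L M)) (sym (+-assoc _ _ _))

  ∑-concatMap : ∀ {A B} (g : A → List B) (L : List A) {f : B → Carrier} →
                ∑ (concatMap g L) f ≈ ∑[ x ∈ L ] ∑ (g x) f
  ∑-concatMap g [] = refl
  ∑-concatMap g (x ∷ L) = trans (∑-++ (g x) (concatMap g L)) (+-congˡ (∑-concatMap g L))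

  ∑-map : ∀ {A B} (g : A → B) (L : List A) {f : B → Carrier} → ∑ (map g L) f ≡ ∑[ x ∈ L ] f (g x)
  ∑-map g L = ≡.cong (sumR R) (≡.sym (map-∘ L))

  ∑-filter : ∀ {A} {P : A → Set} (P? : Decidable P) (L : List A) {f : A → Carrier} →
             ∑ (filter P? L) f ≈ ∑[ x ∈ L ] indicator (P? x) (f x)
  ∑-filter P? [] = refl
  ∑-filter P? (x ∷ L) with does (P? x)
  ... | true = +-congˡ (∑-filter P? L)
  ... | false = trans (∑-filter P? L) (sym (+-identityˡ _))

  ∑-upTo-suc : ∀ N {f : ℕ → Carrier} → ∑ (upTo (suc N)) f ≡ f 0 + ∑[ x ∈ upTo N ] f (suc x)
  ∑-upTo-suc N {f} = ≡.cong (λ L → f 0 + sumR R L)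
    (≡.trans (map-applyUpTo suc f N) (≡.sym (map-upTo (f ∘ suc) N)))

  ∑-upTo-pick : ∀ N {k} {f : ℕ → Carrier} → k < N → (∀ x → x ≢ k → f x ≈ 0#) →
                ∑ (upTo N) f ≈ f k
  ∑-upTo-pick (suc N) {zero} {f} _ f≈0 = begin
    ∑ (upTo (suc N)) f
      ≡⟨ ∑-upTo-suc N ⟩
    f 0 + ∑[ x ∈ upTo N ] f (suc x)
      ≈⟨ +-congˡ (∑-zero (upTo N) (λ x → f≈0 (suc x) λ ())) ⟩
    f 0 + 0#
      ≈⟨ +-identityʳ _ ⟩
    f 0 ∎
  ∑-upTo-pick (suc N) {suc k} {f} (s≤s k<N) f≈0 = begin
    ∑ (upTo (suc N)) f
      ≡⟨ ∑-upTo-suc N ⟩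
    f 0 + ∑[ x ∈ upTo N ] f (suc x)
      ≈⟨ +-cong (f≈0 0 λ ()) (∑-upTo-pick N k<N λ x x≢k → f≈0 (suc x) (x≢k ∘ suc-injective)) ⟩
    0# + f (suc k)
      ≈⟨ +-identityˡ _ ⟩
    f (suc k) ∎

  ∑-lists-suc : ∀ m H {f : List ℕ → Carrier} →
                ∑ (lists (suc m) H) f ≈ ∑[ x ∈ upTo (suc H) ] ∑[ xs ∈ lists m H ] f (x ∷ xs)
  ∑-lists-suc m H {f} = trans (∑-concatMap (λ x → map (x ∷_) (lists m H)) (upTo (suc H)))
    (∑-cong (upTo (suc H)) λ x → reflexive (∑-map (x ∷_) (lists m H) {f}))

  ∑-lists-cong-∷ : ∀ m H {f g : List ℕ → Carrier} → (∀ y ys → f (y ∷ ys) ≈ g (y ∷ ys)) →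
                   ∑ (lists (suc m) H) f ≈ ∑ (lists (suc m) H) g
  ∑-lists-cong-∷ m H f≈g = trans (∑-lists-suc m H)
    (trans (∑-cong (upTo (suc H)) λ y → ∑-cong (lists m H) (f≈g y)) (sym (∑-lists-suc m H)))

  ∑-lists-head : ∀ m {k H} {f : List ℕ → Carrier} → k ≤ H →
                 ∑[ xs ∈ lists (suc m) H ] indicator (firstIs? k xs) (f xs) ≈ ∑[ ys ∈ lists m H ] f (k ∷ ys)
  ∑-lists-head m {k} {H} {f} k≤H = begin
    ∑[ xs ∈ lists (suc m) H ] indicator (firstIs? k xs) (f xs)
      ≈⟨ ∑-lists-suc m H ⟩
    ∑[ x ∈ upTo (suc H) ] ∑[ ys ∈ lists m H ] indicator (x ≟ k) (f (x ∷ ys))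
      ≈⟨ ∑-cong (upTo (suc H)) (λ x → ∑-indicator (x ≟ k) (lists m H)) ⟩
    ∑[ x ∈ upTo (suc H) ] indicator (x ≟ k) (∑[ ys ∈ lists m H ] f (x ∷ ys))
      ≈⟨ ∑-upTo-pick (suc H) (s≤s k≤H) (λ x x≢k → reflexive (indicator-no (x ≟ k) x≢k)) ⟩
    indicator (k ≟ k) (∑[ ys ∈ lists m H ] f (k ∷ ys))
      ≡⟨ indicator-yes (k ≟ k) ≡.refl ⟩
    ∑[ ys ∈ lists m H ] f (k ∷ ys) ∎

  module QPascal (q r K : Carrier) (f : ℕ → ℕ → Carrier)
    (f-init : f 0 1 ≈ K)
    (f-zero : ∀ n → f n 0 ≈ 0#)
    (f-short : ∀ k → f 0 (2 ℕ+ k) ≈ 0#)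
    (f-step : ∀ n k → f (suc n) (suc k) ≈ pow R q (suc k) · f n (suc k) + pow R q k · r · f n k)
    where

    closed-form : ∀ n h → f n (suc h) ≈ K · pow R q (h C 2 ℕ+ n) · pow R r h · qbinom R q n h
    closed-form zero zero = trans f-init (sym (trans (*-identityʳ _) (trans (*-identityʳ _) (*-identityʳ _))))
    closed-form zero (suc h) = trans (f-short h) (sym (zeroʳ _))
    closed-form (suc n) zero = begin
      f (suc n) 1
        ≈⟨ f-step n 0 ⟩
      pow R q 1 · f n 1 + pow R q 0 · r · f n 0
        ≈⟨ +-cong (*-congˡ (closed-form n 0)) (*-congˡ (f-zero n)) ⟩
      (q · 1#) · (K · pow R q n · 1# · 1#) + 1# · r · 0#
        ≈⟨ solve 4 (λ q r K X → (q :* con 1) :* (K :* X :* con 1 :* con 1) :+ con 1 :* r :* con 0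
                              := K :* (q :* X) :* con 1 :* con 1) refl q r K (pow R q n) ⟩
      K · (q · pow R q n) · 1# · 1# ∎
    closed-form (suc n) (suc h) = begin
      f (suc n) (2 ℕ+ h)
        ≈⟨ f-step n (suc h) ⟩
      pow R q (2 ℕ+ h) · f n (2 ℕ+ h) + pow R q (suc h) · r · f n (suc h)
        ≈⟨ +-cong (*-congˡ (closed-form n (suc h))) (*-congˡ (closed-form n h)) ⟩
      (q · (q · qʰ)) · (K · pow R q (suc h C 2 ℕ+ n) · (r · rʰ) · B₁)
        + (q · qʰ) · r · (K · X · rʰ · B₀)
        ≈⟨ +-congʳ (*-congˡ (*-congʳ (*-congʳ (*-congˡ (pow-C2-suc q h n))))) ⟩
      (q · (q · qʰ)) · (K · (qʰ · X) · (r · rʰ) · B₁) + (q · qʰ) · r · (K · X · rʰ · B₀)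
        ≈⟨ solve 8 (λ q r K qʰ rʰ X B₀ B₁ →
             (q :* (q :* qʰ)) :* (K :* (qʰ :* X) :* (r :* rʰ) :* B₁) :+ (q :* qʰ) :* r :* (K :* X :* rʰ :* B₀)
             := K :* (q :* (qʰ :* X)) :* (r :* rʰ) :* (B₀ :+ (q :* qʰ) :* B₁)) refl q r K qʰ rʰ X B₀ B₁ ⟩
      K · (q · (qʰ · X)) · (r · rʰ) · (B₀ + (q · qʰ) · B₁)
        ≈⟨ *-congʳ (*-congʳ (*-congˡ (*-congˡ (sym (pow-C2-suc q h n))))) ⟩
      K · (q · pow R q (suc h C 2 ℕ+ n)) · (r · rʰ) · (B₀ + (q · qʰ) · B₁)
        ≡⟨ ≡.cong (λ m → K · pow R q m · (r · rʰ) · (B₀ + (q · qʰ) · B₁)) (+-suc (suc h C 2) n) ⟨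
      K · pow R q (suc h C 2 ℕ+ suc n) · pow R r (suc h) · qbinom R q (suc n) (suc h) ∎
      where
      qʰ = pow R q h
      rʰ = pow R r h
      X = pow R q (h C 2 ℕ+ n)
      B₀ = qbinom R q n h
      B₁ = qbinom R q n (suc h)

  rescale : ∀ {q r e} → r ≈ q · e → ∀ K h n B →
            K · pow R q (h C 2 ℕ+ n) · pow R r h · B ≈ K · pow R q (suc h C 2 ℕ+ n) · pow R e h · B
  rescale {q} {r} {e} r≈qe K h n B = begin
    K · X · pow R r h · B        ≈⟨ *-congʳ (*-congˡ (trans (pow-congˡ h r≈qe) (pow-distrib-· q e h))) ⟩
    K · X · (qʰ · pow R e h) · B ≈⟨ solve 5 (λ K X qʰ eʰ B → K :* X :* (qʰ :* eʰ) :* B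
                                                        := K :* (qʰ :* X) :* eʰ :* B)
                                          refl K X qʰ (pow R e h) B ⟩
    K · (qʰ · X) · pow R e h · B ≈⟨ *-congʳ (*-congʳ (*-congˡ (sym (pow-C2-suc q h n)))) ⟩
    K · pow R q (suc h C 2 ℕ+ n) · pow R e h · B ∎
    where
    qʰ = pow R q h
    X = pow R q (h C 2 ℕ+ n)

  module _ (a b c d : Carrier) where

    Q : Carrier
    Q = a · b · c · d

    partWeight : Bool → ℕ → Carrier
    partWeight true x = pow R a ⌈ x /2⌉ · pow R b ⌊ x /2⌋
    partWeight false x = pow R c ⌈ x /2⌉ · pow R d ⌊ x /2⌋

    ωFrom : Bool → List ℕ → Carrier
    ωFrom true = ωodd R a b c d
    ωFrom false = ωeven R a b c d

    ωFrom-∷ : ∀ p x xs → ωFrom p (x ∷ xs) ≡ partWeight p x · ωFrom (not p) xs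
    ωFrom-∷ true x xs = ≡.refl
    ωFrom-∷ false x xs = ≡.refl

    tailWeight : Bool → ℕ → List ℕ → Carrier
    tailWeight p k xs = indicator (firstIs? k xs) (indicator (validTail? p xs) (ωFrom p xs))

    tails : Bool → ℕ → ℕ → Carrier
    tails p zero k = 0#
    tails p (suc zero) k = indicator (validTail? p [ k ]) (ωFrom p [ k ])
    tails p (suc (suc m)) k =
      indicator (admissible? p k) (partWeight p k · (tails (not p) (suc m) k + tails (not p) (suc m) (k ∸ 1)))

    indicator-validTail-∷∷ : ∀ p k y ys →
      indicator (validTail? p (k ∷ y ∷ ys)) (ωFrom p (k ∷ y ∷ ys))
        ≈ indicator (admissible? p k)
            (partWeight p k · (tailWeight (not p) k (y ∷ ys) + tailWeight (not p) (k ∸ 1) (y ∷ ys)))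
    indicator-validTail-∷∷ p zero y ys = refl  -- 0 is never admissible
    indicator-validTail-∷∷ p (suc k) y ys = begin
      indicator (validTail? p (suc k ∷ y ∷ ys)) (ωFrom p (suc k ∷ y ∷ ys))
        ≡⟨ ≡.trans (indicator-× A? (adjacent? ×-dec valid?))
                   (≡.cong (indicator A?) (indicator-× adjacent? valid?)) ⟩
      indicator A? (indicator adjacent? V)
        ≈⟨ indicator-cong A? (indicator-adjacent y k) ⟩
      indicator A? (indicator (y ≟ suc k) V + indicator (y ≟ k) V)
        ≈⟨ indicator-cong A? (+-cong (extract (y ≟ suc k)) (extract (y ≟ k))) ⟩
      indicator A? (w · tailWeight q (suc k) (y ∷ ys) + w · tailWeight q k (y ∷ ys))
        ≈⟨ indicator-cong A? (sym (distribˡ w _ _)) ⟩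
      indicator A? (w · (tailWeight q (suc k) (y ∷ ys) + tailWeight q k (y ∷ ys))) ∎
      where
      q = not p
      w = partWeight p (suc k)
      A? = admissible? p (suc k)
      adjacent? = y ≤? suc k ×-dec suc k ≤? suc y
      valid? = validTail? q (y ∷ ys)
      V = indicator valid? (ωFrom p (suc k ∷ y ∷ ys))
      extract : ∀ {E} (E? : Dec E) → indicator E? V ≈ w · indicator E? (indicator valid? (ωFrom q (y ∷ ys)))
      extract E? = begin
        indicator E? V
          ≡⟨ ≡.cong (λ ω → indicator E? (indicator valid? ω)) (ωFrom-∷ p (suc k) (y ∷ ys)) ⟩
        indicator E? (indicator valid? (w · ωFrom q (y ∷ ys)))
          ≈⟨ trans (indicator-cong E? (indicator-*ˡ valid?)) (indicator-*ˡ E?) ⟩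
        w · indicator E? (indicator valid? (ωFrom q (y ∷ ys))) ∎

    ∑-tailWeight : ∀ p m {k H} → k ≤ H → ∑ (lists m H) (tailWeight p k) ≈ tails p m k
    ∑-tailWeight p zero _ = +-identityʳ 0#
    ∑-tailWeight p (suc zero) k≤H = trans (∑-lists-head 0 k≤H) (+-identityʳ _)
    ∑-tailWeight p (suc (suc m)) {k} {H} k≤H = begin
      ∑ (lists (2 ℕ+ m) H) (tailWeight p k)
        ≈⟨ ∑-lists-head (suc m) k≤H ⟩
      ∑[ ys ∈ L ] indicator (validTail? p (k ∷ ys)) (ωFrom p (k ∷ ys))
        ≈⟨ ∑-lists-cong-∷ m H (indicator-validTail-∷∷ p k) ⟩
      ∑[ ys ∈ L ] indicator A? (w · (tailWeight q k ys + tailWeight q (k ∸ 1) ys))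
        ≈⟨ ∑-indicator A? L ⟩
      indicator A? (∑[ ys ∈ L ] (w · (tailWeight q k ys + tailWeight q (k ∸ 1) ys)))
        ≈⟨ indicator-cong A? (trans (∑-*ˡ L) (*-congˡ (∑-+ L))) ⟩
      indicator A? (w · (∑ L (tailWeight q k) + ∑ L (tailWeight q (k ∸ 1))))
        ≈⟨ indicator-cong A? (*-congˡ (+-cong (∑-tailWeight q (suc m) k≤H)
                                              (∑-tailWeight q (suc m) (≤-trans (m∸n≤m k 1) k≤H)))) ⟩
      tails p (2 ℕ+ m) k ∎
      where
      q = not p
      w = partWeight p k
      A? = admissible? p k
      L = lists (suc m) H

    BP2≈tails : ∀ m h → BP2 R a b c d m h ≈ tails true m h
    BP2≈tails m h = begin
      BP2 R a b c d m h
        ≈⟨ ∑-filter (selected? h) (lists m h) ⟩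
      ∑[ xs ∈ lists m h ] indicator (selected? h xs) (ωFrom true xs)
        ≡⟨ ≡.cong (sumR R) (map-cong selected≡tailWeight (lists m h)) ⟩
      ∑ (lists m h) (tailWeight true h)
        ≈⟨ ∑-tailWeight true m ≤-refl ⟩
      tails true m h ∎
      where
      selected≡tailWeight : ∀ xs → indicator (selected? h xs) (ωFrom true xs) ≡ tailWeight true h xs
      selected≡tailWeight xs = ≡.trans (indicator-× (inBP2? xs) (firstIs? h xs))
        (≡.trans (indicator-⇔ (validTail⇔ true xs) (inBP2? xs) (validTail? true xs))
                 (indicator-comm (validTail? true xs) (firstIs? h xs)))

    tails-inadmissible : ∀ {p} m {k} → ¬ AdmissiblePart p k → tails p (suc m) k ≈ 0#
    tails-inadmissible {p} zero {k} ¬adm = reflexive (indicator-no (validTail? p [ k ]) (¬adm ∘ proj₁))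
    tails-inadmissible {p} (suc m) {k} ¬adm = reflexive (indicator-no (admissible? p k) ¬adm)

    tails-vanish : ∀ p m {k} → m ℕ+ 3 ≤ k → tails p (suc m) k ≈ 0#
    tails-vanish p zero {k} (s≤s (s≤s (s≤s _))) =
      reflexive (indicator-no (validTail? p [ k ]) λ { (_ , inj₁ ()) ; (_ , inj₂ ()) })
    tails-vanish p (suc m) {suc k} (s≤s m+3≤k) = begin
      indicator A? (w · (tails q (suc m) (suc k) + tails q (suc m) k))
        ≈⟨ indicator-cong A? (*-congˡ (+-cong (tails-vanish q m (m≤n⇒m≤1+n m+3≤k))
                                              (tails-vanish q m m+3≤k))) ⟩
      indicator A? (w · (0# + 0#))
        ≈⟨ indicator-cong A? (trans (*-congˡ (+-identityʳ 0#)) (zeroʳ w)) ⟩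
      indicator A? 0#
        ≡⟨ indicator-0# A? ⟩
      0# ∎
      where
      q = not p
      w = partWeight p (suc k)
      A? = admissible? p (suc k)

    continuation-weights : ∀ k E₁ E₀ →
      partWeight true (2 ℕ+ 2 ℕ* k)
        · (partWeight false (2 ℕ+ 2 ℕ* k) · E₁ + partWeight false (1 ℕ+ 2 ℕ* k) · E₀)
        ≈ pow R Q (suc k) · E₁ + pow R Q k · (a · b · c) · E₀
    continuation-weights k E₁ E₀ = begin
      (a · pow R a ⌈ 2 ℕ* k /2⌉) · (b · pow R b ⌊ 2 ℕ* k /2⌋)
        · ((c · pow R c ⌈ 2 ℕ* k /2⌉) · (d · pow R d ⌊ 2 ℕ* k /2⌋) · E₁
           + (c · pow R c ⌊ 2 ℕ* k /2⌋) · pow R d ⌈ 2 ℕ* k /2⌉ · E₀)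
        ≡⟨ ≡.cong₂ (λ i j → (a · pow R a i) · (b · pow R b j)
                              · ((c · pow R c i) · (d · pow R d j) · E₁ + (c · pow R c j) · pow R d i · E₀))
                   (⌈2*n/2⌉≡n k) (⌊2*n/2⌋≡n k) ⟩
      (a · aᵏ) · (b · bᵏ) · ((c · cᵏ) · (d · dᵏ) · E₁ + (c · cᵏ) · dᵏ · E₀)
        ≈⟨ solve 10 (λ a b c d aᵏ bᵏ cᵏ dᵏ E₀ E₁ →
             (a :* aᵏ) :* (b :* bᵏ) :* ((c :* cᵏ) :* (d :* dᵏ) :* E₁ :+ (c :* cᵏ) :* dᵏ :* E₀)
             := (a :* b :* c :* d) :* (aᵏ :* bᵏ :* cᵏ :* dᵏ) :* E₁
                :+ (aᵏ :* bᵏ :* cᵏ :* dᵏ) :* (a :* b :* c) :* E₀)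
             refl a b c d aᵏ bᵏ cᵏ dᵏ E₀ E₁ ⟩
      Q · (aᵏ · bᵏ · cᵏ · dᵏ) · E₁ + (aᵏ · bᵏ · cᵏ · dᵏ) · (a · b · c) · E₀
        ≈⟨ +-cong (*-congʳ (*-congˡ (sym Qᵏ≈))) (*-congʳ (*-congʳ (sym Qᵏ≈))) ⟩
      pow R Q (suc k) · E₁ + pow R Q k · (a · b · c) · E₀ ∎
      where
      aᵏ = pow R a k
      bᵏ = pow R b k
      cᵏ = pow R c k
      dᵏ = pow R d k
      Qᵏ≈ : pow R Q k ≈ aᵏ · bᵏ · cᵏ · dᵏ
      Qᵏ≈ = trans (pow-distrib-· (a · b · c) d k)
                  (*-congʳ (trans (pow-distrib-· (a · b) c k) (*-congʳ (pow-distrib-· a b k))))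

    tails-step : ∀ m k →
      tails true (3 ℕ+ m) (2 ℕ* suc k)
        ≈ pow R Q (suc k) · tails true (suc m) (2 ℕ* suc k)
          + pow R Q k · (a · b · c) · tails true (suc m) (2 ℕ* k)
    tails-step m k = begin
      tails true (3 ℕ+ m) (2 ℕ* suc k)
        ≡⟨ ≡.cong (tails true (3 ℕ+ m)) (*-suc 2 k) ⟩
      indicator (admissible? true (2 ℕ+ 2 ℕ* k)) (w₁ · (w₂ · (E₁ + O) + w₂′ · (O + E₀)))
        ≡⟨ indicator-yes (admissible? true (2 ℕ+ 2 ℕ* k)) (s≤s z≤n , 2∣2+2*n k) ⟩
      w₁ · (w₂ · (E₁ + O) + w₂′ · (O + E₀))
        ≈⟨ *-congˡ (+-cong (*-congˡ (trans (+-congˡ O≈0) (+-identityʳ E₁)))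
                           (*-congˡ (trans (+-congʳ O≈0) (+-identityˡ E₀)))) ⟩
      w₁ · (w₂ · E₁ + w₂′ · E₀)
        ≈⟨ continuation-weights k E₁ E₀ ⟩
      pow R Q (suc k) · E₁ + pow R Q k · (a · b · c) · E₀
        ≡⟨ ≡.cong (λ x → pow R Q (suc k) · tails true (suc m) x + pow R Q k · (a · b · c) · E₀)
                  (*-suc 2 k) ⟨
      pow R Q (suc k) · tails true (suc m) (2 ℕ* suc k) + pow R Q k · (a · b · c) · E₀ ∎
      where
      w₁ = partWeight true (2 ℕ+ 2 ℕ* k)
      w₂ = partWeight false (2 ℕ+ 2 ℕ* k)
      w₂′ = partWeight false (1 ℕ+ 2 ℕ* k)
      E₀ = tails true (suc m) (2 ℕ* k)
      E₁ = tails true (suc m) (2 ℕ+ 2 ℕ* k)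
      O = tails true (suc m) (1 ℕ+ 2 ℕ* k)
      O≈0 : O ≈ 0#
      O≈0 = tails-inadmissible m (2∤1+2*n k ∘ proj₂)

    BP2-odd : ∀ n h → BP2 R a b c d (suc (2 ℕ* n)) (2 ℕ* suc h)
                        ≈ a · b · pow R Q (h C 2 ℕ+ n) · pow R (a · b · c) h · qbinom R Q n h
    BP2-odd n h = trans (BP2≈tails (suc (2 ℕ* n)) (2 ℕ* suc h))
                        (QPascal.closed-form Q (a · b · c) (a · b) f f-init f-zero f-short f-step n h)
      where
      f : ℕ → ℕ → Carrier
      f n k = tails true (suc (2 ℕ* n)) (2 ℕ* k)
      f-init : f 0 1 ≈ a · b
      f-init = solve 2 (λ a b → (a :* con 1) :* (b :* con 1) :* con 1 := a :* b) refl a b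
      f-zero : ∀ n → f n 0 ≈ 0#
      f-zero n = tails-inadmissible (2 ℕ* n) λ { (() , _) }
      f-short : ∀ k → f 0 (2 ℕ+ k) ≈ 0#
      f-short k = tails-vanish true 0 (≤-trans (n≤1+n 3) (*-monoʳ-≤ 2 (m≤m+n 2 k)))
      f-step : ∀ n k → f (suc n) (suc k) ≈ pow R Q (suc k) · f n (suc k) + pow R Q k · (a · b · c) · f n k
      f-step n k = trans (reflexive (≡.cong (λ m → tails true (suc m) (2 ℕ* suc k)) (*-suc 2 n)))
                         (tails-step (2 ℕ* n) k)

    BP2-even : ∀ n h → BP2 R a b c d (2 ℕ* suc n) (2 ℕ* suc h)
                         ≈ (Q + a · b · c) · pow R Q (h C 2 ℕ+ n) · pow R (a · b · c) h · qbinom R Q n h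
    BP2-even n h = begin
      BP2 R a b c d (2 ℕ* suc n) (2 ℕ* suc h)  ≈⟨ BP2≈tails (2 ℕ* suc n) (2 ℕ* suc h) ⟩
      tails true (2 ℕ* suc n) (2 ℕ* suc h)    ≡⟨ ≡.cong (λ m → tails true m (2 ℕ* suc h)) (*-suc 2 n) ⟩
      g n (suc h)
        ≈⟨ QPascal.closed-form Q (a · b · c) (Q + a · b · c) g g-init g-zero g-short g-step n h ⟩
      (Q + a · b · c) · pow R Q (h C 2 ℕ+ n) · pow R (a · b · c) h · qbinom R Q n h ∎
      where
      g : ℕ → ℕ → Carrier
      g n k = tails true (2 ℕ+ 2 ℕ* n) (2 ℕ* k)
      g-init : g 0 1 ≈ Q + a · b · c
      g-init = solve 4 (λ a b c d →
                 (a :* con 1) :* (b :* con 1)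
                   :* ((c :* con 1) :* (d :* con 1) :* con 1 :+ (c :* con 1) :* con 1 :* con 1)
                 := a :* b :* c :* d :+ a :* b :* c) refl a b c d
      g-zero : ∀ n → g n 0 ≈ 0#
      g-zero n = tails-inadmissible {true} (suc (2 ℕ* n)) {0} λ { (() , _) }
      g-short : ∀ k → g 0 (2 ℕ+ k) ≈ 0#
      g-short k = tails-vanish true 1 (*-monoʳ-≤ 2 (m≤m+n 2 k))
      g-step : ∀ n k → g (suc n) (suc k) ≈ pow R Q (suc k) · g n (suc k) + pow R Q k · (a · b · c) · g n k
      g-step n k = trans (reflexive (≡.cong (λ m → tails true (2 ℕ+ m) (2 ℕ* suc k)) (*-suc 2 n)))
                         (tails-step (suc (2 ℕ* n)) k)

mainTheorem9 : ∀ {c ℓ} (R : CommutativeRing c ℓ) →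
    let open CommutativeRing R renaming (_*_ to _·_) in
    (a b c d d⁻¹ : Carrier) → d · d⁻¹ ≈ 1# →
    (n h : ℕ) → 1 ≤ n → 1 ≤ h →
      (BP2 R a b c d (2 ℕ* n) (2 ℕ* h)
         ≈ pow R (a · b · c · d) (h C 2 ℕ+ n) · (1# + d⁻¹) · pow R d⁻¹ (h ∸ 1)
           · qbinom R (a · b · c · d) (n ∸ 1) (h ∸ 1))
      × (BP2 R a b c d (2 ℕ* n ∸ 1) (2 ℕ* h)
         ≈ a · b · pow R (a · b · c · d) (h C 2 ℕ+ n ∸ 1) · pow R d⁻¹ (h ∸ 1)
           · qbinom R (a · b · c · d) (n ∸ 1) (h ∸ 1))
mainTheorem9 R a b c d d⁻¹ dd⁻¹≈1 (suc n) (suc h) _ _ = even , odd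
  where
  open CommutativeRing R renaming (_*_ to _·_)
  open import Algebra.Solver.Ring.NaturalCoefficients.Default commutativeSemiring using (solve; _:=_; _:+_; _:*_; con)
  open import Relation.Binary.Reasoning.Setoid setoid
  abcd = a · b · c · d
  P = pow R abcd (suc h C 2 ℕ+ n)
  B = qbinom R abcd n h
  abc≈abcd·d⁻¹ : a · b · c ≈ abcd · d⁻¹
  abc≈abcd·d⁻¹ = trans (sym (trans (*-congˡ dd⁻¹≈1) (*-identityʳ _))) (sym (*-assoc _ _ _))
  even = begin
    BP2 R a b c d (2 ℕ* suc n) (2 ℕ* suc h)
      ≈⟨ BP2-even R a b c d n h ⟩
    (abcd + a · b · c) · pow R abcd (h C 2 ℕ+ n) · pow R (a · b · c) h · B
      ≈⟨ rescale R abc≈abcd·d⁻¹ _ h n B ⟩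
    (abcd + a · b · c) · P · pow R d⁻¹ h · B
      ≈⟨ *-congʳ (*-congʳ (trans (*-congʳ (+-congˡ abc≈abcd·d⁻¹))
           (solve 3 (λ Q e P → (Q :+ Q :* e) :* P := Q :* P :* (con 1 :+ e)) refl abcd d⁻¹ P))) ⟩
    abcd · P · (1# + d⁻¹) · pow R d⁻¹ h · B
      ≡⟨ ≡.cong (λ m → pow R abcd m · (1# + d⁻¹) · pow R d⁻¹ h · B) (+-suc (suc h C 2) n) ⟨
    pow R abcd (suc h C 2 ℕ+ suc n) · (1# + d⁻¹) · pow R d⁻¹ h · B ∎
  odd = begin
    BP2 R a b c d (2 ℕ* suc n ∸ 1) (2 ℕ* suc h)
      ≡⟨ ≡.cong (λ m → BP2 R a b c d (m ∸ 1) (2 ℕ* suc h)) (*-suc 2 n) ⟩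
    BP2 R a b c d (suc (2 ℕ* n)) (2 ℕ* suc h)
      ≈⟨ BP2-odd R a b c d n h ⟩
    a · b · pow R abcd (h C 2 ℕ+ n) · pow R (a · b · c) h · B
      ≈⟨ rescale R abc≈abcd·d⁻¹ _ h n B ⟩
    a · b · P · pow R d⁻¹ h · B
      ≡⟨ ≡.cong (λ m → a · b · pow R abcd (m ∸ 1) · pow R d⁻¹ h · B) (+-suc (suc h C 2) n) ⟨
    a · b · pow R abcd (suc h C 2 ℕ+ suc n ∸ 1) · pow R d⁻¹ h · B ∎
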